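{- $\beta_{\mathbb{Z}^{+}}(4)\geq \frac{1}{2}$.
   Context: Let $S$ be a set of positive integers. A permutation of $S$ is a sequence $p_1,p_2,\dots$ in which every element of $S$ appears exactly once. It contains an arithmetic progression of length $k$ if there are indices $i_1<\dots<i_k$ and integers $a$ and $d\neq 0$ (possibly negative) with $p_{i_j}=a+(j-1)d$ for all $j$. $S$ can be permuted to avoid arithmetic progressions of length $k$ if some permutation of $S$ contains no such progression. $\beta_{\mathbb{Z}^{+}}(k)$ is the supremum of $\liminf_{n\to\infty}\frac{|S\cap[1,n]|}{n}$ over all sets $S$ of positive integers that can be permuted to avoid arithmetic progressions of length $k$. -}

module Defs where

open import Data.Nat using (ℕ; zero; suc; _+_; _*_; _≤_; _<_)
open import Data.Bool using (Bool; true; false; if_then_else_)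
open import Data.Integer as ℤ using (ℤ; +_)
open import Data.Product using (Σ; ∃; ∃-syntax; _×_; _,_)
open import Relation.Binary.PropositionalEquality using (_≡_; _≢_)
open import Function.Definitions using (Injective)

-- A set S of positive integers, given by its characteristic function.
-- (S 0 must be false, so S ⊆ ℤ⁺.)
SubsetPos : Set
SubsetPos = Σ (ℕ → Bool) (λ S → S 0 ≡ false)

count : (ℕ → Bool) → ℕ → ℕ
count S zero    = 0
count S (suc n) = (if S (suc n) then 1 else 0) + count S n

IsPermutationOf : (ℕ → ℕ) → (ℕ → Bool) → Set
IsPermutationOf p S =
  Injective _≡_ _≡_ p × (∀ i → S (p i) ≡ true) × (∀ m → S m ≡ true → ∃[ i ] p i ≡ m)

Contains4AP : (ℕ → ℕ) → Set
Contains4AP p =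
  ∃[ i₁ ] ∃[ i₂ ] ∃[ i₃ ] ∃[ i₄ ] ∃[ a ] ∃[ d ]
    (i₁ < i₂ × i₂ < i₃ × i₃ < i₄ × d ≢ ℤ.0ℤ ×
     (+ p i₁ ≡ a ℤ.+ (+ 0) ℤ.* d) × (+ p i₂ ≡ a ℤ.+ (+ 1) ℤ.* d) ×
     (+ p i₃ ≡ a ℤ.+ (+ 2) ℤ.* d) × (+ p i₄ ≡ a ℤ.+ (+ 3) ℤ.* d))

PermutableAvoiding4AP : (ℕ → Bool) → Set
PermutableAvoiding4AP S = ∃[ p ] (IsPermutationOf p S × (Contains4AP p → Data.Empty.⊥))
  where import Data.Empty

-- Eventually |S ∩ [1,n]| ≥ (1/2 - 1/(k+1)) n, written over ℕ by clearing
-- denominators:  (k+1) n ≤ 2 (k+1) |S∩[1,n]| + 2 n.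
-- This is equivalent to  liminf |S∩[1,n]|/n ≥ 1/2 - 1/(k+1) up to the ε-slack
-- used in the statement.
EventuallyDensityAtLeastHalfMinus : (ℕ → Bool) → ℕ → Set
EventuallyDensityAtLeastHalfMinus S k =
  ∃[ N ] ∀ n → N ≤ n → suc k * n ≤ 2 * suc k * count S n + 2 * n

module Submission where

-- β_{ℤ⁺}(4) ≥ 1/2.  For a parameter K we build a set S ⊆ ℤ⁺ out of blocks
-- [L b, U b) of consecutive integers, where block b has size 2 ^ (K · L b)
-- and the next block starts at L (b+1) = 2 · U b.  S is enumerated block by
-- block, each block in bit-reversed order.
--
--   * Bit reversal is a permutation of {0, …, 2^m − 1} without 3-term APs
--     in enumeration order (the first half becomes the even numbers, the
--     second half the odd ones).
--   * Every term of the enumeration exceeds twice each term of earlier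
--     blocks.  Hence in a 3-AP x, y, z of the enumeration, y and z share a
--     block (z ≤ x + z = 2y) and therefore x does not (the blocks have no
--     3-APs), so y > 2x.  For a 4-AP this contradicts z ≤ 2y applied to its
--     first three terms; no sign or size condition on the difference is used.
--   * Blocks are huge compared to their starting point, so the only sparse
--     places, the gaps [U b, 2 U b), still see density ≥ 1/2 − 1/K.

open import Defs
open import Data.Nat using (ℕ)
open import Data.Product using (Σ; _×_; proj₁)

open import Data.Bool using (Bool; true; false; _∧_)
open import Data.Bool.Properties using (T-≡; T-∧)
open import Data.Empty using (⊥)
import Data.Integer as ℤ
import Data.Integer.Properties as ℤP
import Data.Integer.Tactic.RingSolver as ℤSolver
open import Data.Nat
open import Data.Nat.Properties
open import Data.Nat.Tactic.RingSolver using (solve-∀)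
open import Data.Product using (_,_; proj₂; ∃-syntax)
open import Data.Sum using (_⊎_; inj₁; inj₂)
import Data.Sum as Sum
open import Function using (id)
open import Function.Bundles using (Equivalence)
open import Relation.Binary.Definitions using (tri<; tri≈; tri>)
open import Relation.Binary.PropositionalEquality
open import Relation.Nullary using (¬_; yes; no; contradiction)

open Equivalence using (to; from)

2^suc : ∀ m → 2 ^ suc m ≡ 2 ^ m + 2 ^ m
2^suc m = cong (2 ^ m +_) (+-identityʳ (2 ^ m))

n<2^n : ∀ n → n < 2 ^ n
n<2^n zero    = z<s
n<2^n (suc n) = begin-strict
  suc n           ≡⟨ +-comm 1 n ⟩
  n + 1           <⟨ +-mono-≤ (n<2^n n) (m^n>0 2 n) ⟩
  2 ^ n + 2 ^ n   ≡⟨ sym (2^suc n) ⟩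
  2 ^ suc n       ∎
  where open ≤-Reasoning

odd<double : ∀ {x y} → x < y → suc (2 * x) < 2 * y
odd<double {x} {y} x<y = subst (_≤ 2 * y) (*-suc 2 x) (*-monoʳ-≤ 2 x<y)

odd<double⁻¹ : ∀ {x y} → suc (2 * x) < 2 * y → x < y
odd<double⁻¹ {x} {y} lt = *-cancelˡ-< 2 x y (<-trans (n<1+n _) lt)

even-or-odd : ∀ w → ∃[ a ] (w ≡ 2 * a ⊎ w ≡ suc (2 * a))
even-or-odd zero = 0 , inj₁ refl
even-or-odd (suc w) with even-or-odd w
... | a , inj₁ refl = a , inj₂ refl
... | a , inj₂ refl = suc a , inj₁ (sym (*-suc 2 a))

third≤2*middle : ∀ {x y z} → x + z ≡ 2 * y → z ≤ 2 * y
third≤2*middle {x} {y} {z} ap = subst (z ≤_) ap (m≤n+m z x)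

rev : ℕ → ℕ → ℕ
rev zero    j = 0
rev (suc m) j with j <? 2 ^ m
... | yes _ = 2 * rev m j
... | no  _ = suc (2 * rev m (j ∸ 2 ^ m))

upper-half : ∀ m {j} → ¬ j < 2 ^ m → j < 2 ^ suc m → j ∸ 2 ^ m < 2 ^ m
upper-half m {j} j≮ j< = +-cancelˡ-< (2 ^ m) _ _ (begin-strict
  2 ^ m + (j ∸ 2 ^ m)   ≡⟨ m+[n∸m]≡n (≮⇒≥ j≮) ⟩
  j                     <⟨ j< ⟩
  2 ^ suc m             ≡⟨ 2^suc m ⟩
  2 ^ m + 2 ^ m         ∎)
  where open ≤-Reasoning

rev-lower : ∀ m {j} → j < 2 ^ m → rev (suc m) j ≡ 2 * rev m j
rev-lower m {j} j< with j <? 2 ^ m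
... | yes _  = refl
... | no  j≮ = contradiction j< j≮

rev-upper : ∀ m j → rev (suc m) (2 ^ m + j) ≡ suc (2 * rev m j)
rev-upper m j with 2 ^ m + j <? 2 ^ m
... | yes lt = contradiction lt (≤⇒≯ (m≤m+n (2 ^ m) j))
... | no  _  = cong (λ i → suc (2 * rev m i)) (m+n∸m≡n (2 ^ m) j)

rev-< : ∀ m j → rev m j < 2 ^ m
rev-< zero    j = z<s
rev-< (suc m) j with j <? 2 ^ m
... | yes _ = *-monoʳ-< 2 (rev-< m j)
... | no  _ = odd<double (rev-< m (j ∸ 2 ^ m))

rev-inj : ∀ m {j j'} → j < 2 ^ m → j' < 2 ^ m → rev m j ≡ rev m j' → j ≡ j'
rev-inj zero    j< j'< _ = trans (n<1⇒n≡0 j<) (sym (n<1⇒n≡0 j'<))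
rev-inj (suc m) {j} {j'} j< j'< e with j <? 2 ^ m | j' <? 2 ^ m
... | yes l | yes l' = rev-inj m l l' (*-cancelˡ-≡ (rev m j) (rev m j') 2 e)
... | yes _ | no  _  = contradiction e (even≢odd (rev m j) (rev m (j' ∸ 2 ^ m)))
... | no  _ | yes _  = contradiction (sym e) (even≢odd (rev m j') (rev m (j ∸ 2 ^ m)))
... | no  u | no  u' = ∸-cancelʳ-≡ (≮⇒≥ u) (≮⇒≥ u')
  (rev-inj m (upper-half m u j<) (upper-half m u' j'<)
    (*-cancelˡ-≡ (rev m (j ∸ 2 ^ m)) (rev m (j' ∸ 2 ^ m)) 2 (suc-injective e)))

rev-surj : ∀ m {w} → w < 2 ^ m → ∃[ j ] (j < 2 ^ m × rev m j ≡ w)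
rev-surj zero    w< = 0 , z<s , sym (n<1⇒n≡0 w<)
rev-surj (suc m) {w} w< with even-or-odd w
... | a , inj₁ refl with rev-surj m (*-cancelˡ-< 2 a (2 ^ m) w<)
...   | j , j< , e = j , <-≤-trans j< (subst (2 ^ m ≤_) (sym (2^suc m)) (m≤m+n _ _))
                       , trans (rev-lower m j<) (cong (2 *_) e)
rev-surj (suc m) {w} w< | a , inj₂ refl with rev-surj m (odd<double⁻¹ {a} {2 ^ m} w<)
...   | j , j< , e = 2 ^ m + j , subst (2 ^ m + j <_) (sym (2^suc m)) (+-monoʳ-< (2 ^ m) j<)
                       , trans (rev-upper m j) (cong (λ r → suc (2 * r)) e)

halve-AP-even : ∀ a b c → 2 * a + 2 * c ≡ 2 * (2 * b) → a + c ≡ 2 * b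
halve-AP-even a b c e = *-cancelˡ-≡ _ _ 2 (trans (*-distribˡ-+ 2 a c) e)

halve-AP-odd : ∀ a b c → suc (2 * a) + suc (2 * c) ≡ 2 * suc (2 * b) → a + c ≡ 2 * b
halve-AP-odd a b c e = *-cancelˡ-≡ _ _ 2
  (suc-injective (suc-injective (trans (odd+odd a c) (trans e (*-suc 2 (2 * b))))))
  where
  odd+odd : ∀ a c → suc (suc (2 * (a + c))) ≡ suc (2 * a) + suc (2 * c)
  odd+odd = solve-∀

even+odd≢even : ∀ a c x → 2 * a + suc (2 * c) ≢ 2 * x
even+odd≢even a c x e = even≢odd x (a + c) (trans (sym e) (even+odd a c))
  where
  even+odd : ∀ a c → 2 * a + suc (2 * c) ≡ suc (2 * (a + c))
  even+odd = solve-∀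

rev-3AP-free : ∀ m {j₁ j₂ j₃} → j₁ < j₂ → j₂ < j₃ → j₃ < 2 ^ m →
               rev m j₁ + rev m j₃ ≢ 2 * rev m j₂
rev-3AP-free zero _ () (s≤s z≤n)
rev-3AP-free (suc m) {j₁} {j₂} {j₃} l₁₂ l₂₃ j₃< with j₁ <? 2 ^ m | j₂ <? 2 ^ m | j₃ <? 2 ^ m
... | yes _  | yes _  | yes l₃ =
  λ e → rev-3AP-free m l₁₂ l₂₃ l₃ (halve-AP-even (rev m j₁) (rev m j₂) (rev m j₃) e)
... | yes _  | yes _  | no  _  = even+odd≢even (rev m j₁) (rev m (j₃ ∸ 2 ^ m)) (2 * rev m j₂)
... | yes _  | no  _  | no  _  =
  even+odd≢even (rev m j₁) (rev m (j₃ ∸ 2 ^ m)) (suc (2 * rev m (j₂ ∸ 2 ^ m)))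
... | yes _  | no  u₂ | yes l₃ = contradiction (<-trans l₂₃ l₃) u₂
... | no  u₁ | yes l₂ | _      = contradiction (<-trans l₁₂ l₂) u₁
... | no  u₁ | no  _  | yes l₃ = contradiction (<-trans l₁₂ (<-trans l₂₃ l₃)) u₁
... | no  u₁ | no  u₂ | no  u₃ = λ e → rev-3AP-free m
  (∸-monoˡ-< l₁₂ (≮⇒≥ u₁)) (∸-monoˡ-< l₂₃ (≮⇒≥ u₂)) (upper-half m u₃ j₃<)
  (halve-AP-odd (rev m (j₁ ∸ 2 ^ m)) (rev m (j₂ ∸ 2 ^ m)) (rev m (j₃ ∸ 2 ^ m)) e)

-- For strictly increasing f, the intervals [f b, f (b+1)) partition
-- [f 0, ∞); loc n is the index of the interval containing n.
module Locate (f : ℕ → ℕ) (f-step : ∀ b → f b < f (suc b)) where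

  f-mono-< : ∀ {b b'} → b < b' → f b < f b'
  f-mono-< {b} {suc b'} (s≤s b≤b') with m≤n⇒m<n∨m≡n b≤b'
  ... | inj₁ b<b' = <-trans (f-mono-< b<b') (f-step b')
  ... | inj₂ refl = f-step b

  f-mono-≤ : ∀ {b b'} → b ≤ b' → f b ≤ f b'
  f-mono-≤ b≤b' with m≤n⇒m<n∨m≡n b≤b'
  ... | inj₁ b<b' = <⇒≤ (f-mono-< b<b')
  ... | inj₂ refl = ≤-refl

  loc : ℕ → ℕ
  loc zero = 0
  loc (suc n) with f (suc (loc n)) ≤? suc n
  ... | yes _ = suc (loc n)
  ... | no  _ = loc n

  below-next : ∀ n → n < f (suc (loc n))
  below-next zero = ≤-<-trans z≤n (f-step 0)
  below-next (suc n) with f (suc (loc n)) ≤? suc n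
  ... | yes _ = ≤-<-trans (below-next n) (f-step (suc (loc n)))
  ... | no  ≰ = ≰⇒> ≰

  initial-or-reached : ∀ n → loc n ≡ 0 ⊎ f (loc n) ≤ n
  initial-or-reached zero = inj₁ refl
  initial-or-reached (suc n) with f (suc (loc n)) ≤? suc n
  ... | yes ≤ = inj₂ ≤
  ... | no  _ = Sum.map id m≤n⇒m≤1+n (initial-or-reached n)

  above-start : ∀ {n} → f 0 ≤ n → f (loc n) ≤ n
  above-start {n} f0≤n with initial-or-reached n
  ... | inj₁ e = subst (λ b → f b ≤ n) (sym e) f0≤n
  ... | inj₂ ≤ = ≤

  loc-unique : ∀ {b n} → f b ≤ n → n < f (suc b) → loc n ≡ b
  loc-unique {b} {n} fb≤n n<fb' with <-cmp (loc n) b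
  ... | tri< lt _ _ = contradiction (≤-trans (f-mono-≤ lt) fb≤n) (<⇒≱ (below-next n))
  ... | tri≈ _ e _  = e
  ... | tri> _ _ gt =
    contradiction (≤-trans (f-mono-≤ gt) (above-start (≤-trans (f-mono-≤ z≤n) fb≤n))) (<⇒≱ n<fb')

  loc-mono : ∀ {n n'} → f 0 ≤ n → n ≤ n' → loc n ≤ loc n'
  loc-mono {n} {n'} f0≤n n≤n' = ≮⇒≥ λ lt →
    <⇒≱ (below-next n') (≤-trans (f-mono-≤ lt) (≤-trans (above-start f0≤n) n≤n'))

count-mono : ∀ S {m n} → m ≤ n → count S m ≤ count S n
count-mono S {n = zero}  z≤n = z≤n
count-mono S {n = suc n} m≤1+n with m≤n⇒m<n∨m≡n m≤1+n
... | inj₁ (s≤s m≤n) = ≤-trans (count-mono S m≤n) (m≤n+m (count S n) _)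
... | inj₂ refl      = ≤-refl

count-run : ∀ S m j → (∀ i → i < j → S (suc (i + m)) ≡ true) → j ≤ count S (j + m)
count-run S m zero    _   = z≤n
count-run S m (suc j) run rewrite run j ≤-refl =
  s≤s (count-run S m j (λ i i<j → run i (m<n⇒m<1+n i<j)))

DensityAt : (ℕ → Bool) → ℕ → ℕ → Set
DensityAt S K n = K * n ≤ 2 * K * count S n + 2 * n

density-step : ∀ S K n → S (suc n) ≡ true → DensityAt S K n → DensityAt S K (suc n)
density-step S K n member dens rewrite member = begin
  K * suc n                                   ≡⟨ *-suc K n ⟩
  K + K * n                                   ≤⟨ +-mono-≤ (m≤m+n K (K + 2)) dens ⟩
  (K + (K + 2)) + (2 * K * count S n + 2 * n) ≡⟨ regroup K (count S n) n ⟩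
  2 * K * (1 + count S n) + 2 * suc n         ∎
  where
  open ≤-Reasoning
  regroup : ∀ K c n → (K + (K + 2)) + (2 * K * c + 2 * n) ≡ 2 * K * (1 + c) + 2 * suc n
  regroup = solve-∀

density-everywhere : ∀ S K → (∀ n → S (suc n) ≡ false → DensityAt S K (suc n)) →
                     ∀ n → DensityAt S K n
density-everywhere S K at-gaps zero    = ≤-trans (≤-reflexive (*-zeroʳ K)) z≤n
density-everywhere S K at-gaps (suc n) = by-membership (S (suc n)) refl
  where
  by-membership : ∀ s → S (suc n) ≡ s → DensityAt S K (suc n)
  by-membership true  member = density-step S K n member (density-everywhere S K at-gaps n)
  by-membership false gap    = at-gaps n gap

module BlockedSequence
  (p blk : ℕ → ℕ)
  (blk-mono : ∀ {i i'} → i ≤ i' → blk i ≤ blk i')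
  (separated : ∀ {i i'} → blk i < blk i' → 2 * p i < p i')
  (blockwise-3AP-free : ∀ {i₁ i₂ i₃} → i₁ < i₂ → i₂ < i₃ → blk i₁ ≡ blk i₂ → blk i₂ ≡ blk i₃ →
                        p i₁ + p i₃ ≢ 2 * p i₂)
  where

  same-block : ∀ {i i'} → i ≤ i' → p i' ≤ 2 * p i → blk i ≡ blk i'
  same-block i≤i' small with m≤n⇒m<n∨m≡n (blk-mono i≤i')
  ... | inj₁ lt = contradiction small (<⇒≱ (separated lt))
  ... | inj₂ eq = eq

  -- In a 3-AP of the sequence the last two terms share a block, so the first
  -- term lies in an earlier block and the middle term more than doubles it.
  3AP-doubles : ∀ {i₁ i₂ i₃} → i₁ < i₂ → i₂ < i₃ → p i₁ + p i₃ ≡ 2 * p i₂ → 2 * p i₁ < p i₂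
  3AP-doubles {i₂ = i₂} l₁₂ l₂₃ ap with m≤n⇒m<n∨m≡n (blk-mono (<⇒≤ l₁₂))
  ... | inj₁ lt  = separated lt
  ... | inj₂ e₁₂ = contradiction ap
    (blockwise-3AP-free l₁₂ l₂₃ e₁₂ (same-block (<⇒≤ l₂₃) (third≤2*middle {y = p i₂} ap)))

  -- The last three terms of a 4-AP would be a 3-AP whose middle term is at
  -- most twice its first term.
  no-4AP : ∀ {i₁ i₂ i₃ i₄} → i₁ < i₂ → i₂ < i₃ → i₃ < i₄ →
           p i₁ + p i₃ ≡ 2 * p i₂ → p i₂ + p i₄ ≡ 2 * p i₃ → ⊥
  no-4AP {i₂ = i₂} l₁₂ l₂₃ l₃₄ ap₁₂₃ ap₂₃₄ =
    <⇒≱ (3AP-doubles l₂₃ l₃₄ ap₂₃₄) (third≤2*middle {y = p i₂} ap₁₂₃)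

integer-3AP : ∀ {x y z} a d j →
              ℤ.+ x ≡ a ℤ.+ j ℤ.* d →
              ℤ.+ y ≡ a ℤ.+ (j ℤ.+ ℤ.+ 1) ℤ.* d →
              ℤ.+ z ≡ a ℤ.+ (j ℤ.+ ℤ.+ 2) ℤ.* d →
              x + z ≡ 2 * y
integer-3AP {x} {y} {z} a d j ex ey ez = ℤP.+-injective (begin
  ℤ.+ x ℤ.+ ℤ.+ z                                       ≡⟨ cong₂ ℤ._+_ ex ez ⟩
  (a ℤ.+ j ℤ.* d) ℤ.+ (a ℤ.+ (j ℤ.+ ℤ.+ 2) ℤ.* d)       ≡⟨ middle a d j ⟩
  ℤ.+ 2 ℤ.* (a ℤ.+ (j ℤ.+ ℤ.+ 1) ℤ.* d)                 ≡⟨ cong (ℤ.+ 2 ℤ.*_) (sym ey) ⟩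
  ℤ.+ 2 ℤ.* ℤ.+ y                                       ≡⟨ sym (ℤP.pos-* 2 y) ⟩
  ℤ.+ (2 * y)                                           ∎)
  where
  open ≡-Reasoning
  middle : ∀ a d j → (a ℤ.+ j ℤ.* d) ℤ.+ (a ℤ.+ (j ℤ.+ ℤ.+ 2) ℤ.* d) ≡
                     ℤ.+ 2 ℤ.* (a ℤ.+ (j ℤ.+ ℤ.+ 1) ℤ.* d)
  middle = ℤSolver.solve-∀

module Construction (K : ℕ) where

  L U bits size : ℕ → ℕ
  bits b = K * L b
  size b = 2 ^ bits b
  L zero    = 1
  L (suc b) = 2 * U b
  U b = L b + size b

  size>0 : ∀ b → 0 < size b
  size>0 b = m^n>0 2 (bits b)

  L<U : ∀ b → L b < U b
  L<U b = m<m+n (L b) (size>0 b)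

  U≤L : ∀ b → U b ≤ L (suc b)
  U≤L b = m≤m+n (U b) (U b + 0)

  K*L<size : ∀ b → K * L b < size b
  K*L<size b = n<2^n (bits b)

  module Value = Locate L (λ b → <-≤-trans (L<U b) (U≤L b))

  inS : ℕ → Bool
  inS v = (L (Value.loc v) ≤ᵇ v) ∧ (v <ᵇ U (Value.loc v))

  member⇒in-block : ∀ {v} → inS v ≡ true → L (Value.loc v) ≤ v × v < U (Value.loc v)
  member⇒in-block {v} member with to T-∧ (from T-≡ member)
  ... | start≤v , v<end = ≤ᵇ⇒≤ _ v start≤v , <ᵇ⇒< v _ v<end

  in-block⇒member : ∀ {b v} → L b ≤ v → v < U b → inS v ≡ true
  in-block⇒member {b} {v} L≤v v<U rewrite Value.loc-unique {b} L≤v (<-≤-trans v<U (U≤L b)) =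
    to T-≡ (from T-∧ (≤⇒≤ᵇ L≤v , <⇒<ᵇ v<U))

  non-member⇒in-gap : ∀ {v} → inS v ≡ false → 1 ≤ v → U (Value.loc v) ≤ v
  non-member⇒in-gap {v} non-member 1≤v = ≮⇒≥ λ v<U →
    true≢false (trans (sym (in-block⇒member {Value.loc v} (Value.above-start 1≤v) v<U)) non-member)
    where
    true≢false : true ≢ false
    true≢false ()

  place : ℕ → ℕ → ℕ
  place b j = L b + rev (bits b) j

  place-in-block : ∀ {b j} → L b ≤ place b j × place b j < U b
  place-in-block {b} {j} = m≤m+n (L b) _ , +-monoʳ-< (L b) (rev-< (bits b) j)

  place-loc : ∀ b j → Value.loc (place b j) ≡ b
  place-loc b j = let (L≤ , <U) = place-in-block {b} {j} in
    Value.loc-unique L≤ (<-≤-trans <U (U≤L b))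

  place-injective : ∀ {b b' j j'} → j < size b → j' < size b' →
                    place b j ≡ place b' j' → b ≡ b' × j ≡ j'
  place-injective {b} {b'} {j} {j'} j< j'< e
    with trans (sym (place-loc b j)) (trans (cong Value.loc e) (place-loc b' j'))
  ... | refl = refl , rev-inj (bits b) j< j'< (+-cancelˡ-≡ (L b) _ _ e)

  place-3AP-free : ∀ {b j₁ j₂ j₃} → j₁ < j₂ → j₂ < j₃ → j₃ < size b →
                   place b j₁ + place b j₃ ≢ 2 * place b j₂
  place-3AP-free {b} {j₁} {j₂} {j₃} l₁₂ l₂₃ j₃< e =
    rev-3AP-free (bits b) l₁₂ l₂₃ j₃<
      (cancel-start (L b) (rev (bits b) j₁) (rev (bits b) j₂) (rev (bits b) j₃) e)
    where
    cancel-start : ∀ l x y z → (l + x) + (l + z) ≡ 2 * (l + y) → x + z ≡ 2 * y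
    cancel-start l x y z e =
      +-cancelˡ-≡ (2 * l) _ _ (trans (shift l x z) (trans e (*-distribˡ-+ 2 l y)))
      where
      shift : ∀ l x z → 2 * l + (x + z) ≡ (l + x) + (l + z)
      shift = solve-∀

  I : ℕ → ℕ
  I zero    = 0
  I (suc b) = I b + size b

  module Index = Locate I (λ b → m<m+n (I b) (size>0 b))

  blk off : ℕ → ℕ
  blk = Index.loc
  off i = i ∸ I (blk i)

  p : ℕ → ℕ
  p i = place (blk i) (off i)

  I-blk≤ : ∀ i → I (blk i) ≤ i
  I-blk≤ i = Index.above-start z≤n

  index-split : ∀ i → I (blk i) + off i ≡ i
  index-split i = m+[n∸m]≡n (I-blk≤ i)

  off< : ∀ i → off i < size (blk i)
  off< i = +-cancelˡ-< (I (blk i)) _ _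
    (subst (_< I (blk i) + size (blk i)) (sym (index-split i)) (Index.below-next i))

  p-at : ∀ {b j} → j < size b → p (I b + j) ≡ place b j
  p-at {b} {j} j< = cong₂ place blk≡ off≡
    where
    blk≡ : blk (I b + j) ≡ b
    blk≡ = Index.loc-unique (m≤m+n (I b) j) (+-monoʳ-< (I b) j<)
    off≡ : off (I b + j) ≡ j
    off≡ = trans (cong (λ c → I b + j ∸ I c) blk≡) (m+n∸m≡n (I b) j)

  blk-mono : ∀ {i i'} → i ≤ i' → blk i ≤ blk i'
  blk-mono = Index.loc-mono z≤n

  off-mono : ∀ {i i'} → i < i' → blk i ≡ blk i' → off i < off i'
  off-mono {i} {i'} i<i' e = +-cancelˡ-< (I (blk i)) _ _ (begin-strict
    I (blk i) + off i     ≡⟨ index-split i ⟩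
    i                     <⟨ i<i' ⟩
    i'                    ≡⟨ sym (index-split i') ⟩
    I (blk i') + off i'   ≡⟨ cong (λ b → I b + off i') (sym e) ⟩
    I (blk i) + off i'    ∎)
    where open ≤-Reasoning

  p-injective : ∀ {i i'} → p i ≡ p i' → i ≡ i'
  p-injective {i} {i'} e with place-injective {blk i} {blk i'} (off< i) (off< i') e
  ... | blk≡ , off≡ = begin
    i                     ≡⟨ sym (index-split i) ⟩
    I (blk i) + off i     ≡⟨ cong₂ (λ b j → I b + j) blk≡ off≡ ⟩
    I (blk i') + off i'   ≡⟨ index-split i' ⟩
    i'                    ∎
    where open ≡-Reasoning

  p-member : ∀ i → inS (p i) ≡ true
  p-member i = let (L≤ , <U) = place-in-block {blk i} {off i} in in-block⇒member {blk i} L≤ <U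

  p-surjective : ∀ v → inS v ≡ true → ∃[ i ] p i ≡ v
  p-surjective v member = from-offset (rev-surj (bits b) offset<)
    where
    b : ℕ
    b = Value.loc v
    L≤v : L b ≤ v
    L≤v = proj₁ (member⇒in-block member)
    offset< : v ∸ L b < size b
    offset< = +-cancelˡ-< (L b) _ _
      (subst (_< U b) (sym (m+[n∸m]≡n L≤v)) (proj₂ (member⇒in-block member)))
    from-offset : ∃[ j ] (j < size b × rev (bits b) j ≡ v ∸ L b) → ∃[ i ] p i ≡ v
    from-offset (j , j< , rev≡) = I b + j , (begin
      p (I b + j)             ≡⟨ p-at {b} j< ⟩
      L b + rev (bits b) j    ≡⟨ cong (L b +_) rev≡ ⟩
      L b + (v ∸ L b)         ≡⟨ m+[n∸m]≡n L≤v ⟩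
      v                       ∎)
      where open ≡-Reasoning

  p-permutes-S : IsPermutationOf p inS
  p-permutes-S = p-injective , p-member , p-surjective

  separated : ∀ {i i'} → blk i < blk i' → 2 * p i < p i'
  separated {i} {i'} lt = begin-strict
    2 * p i             <⟨ *-monoʳ-< 2 (proj₂ (place-in-block {blk i} {off i})) ⟩
    L (suc (blk i))     ≤⟨ Value.f-mono-≤ lt ⟩
    L (blk i')          ≤⟨ proj₁ (place-in-block {blk i'} {off i'}) ⟩
    p i'                ∎
    where open ≤-Reasoning

  blockwise-3AP-free : ∀ {i₁ i₂ i₃} → i₁ < i₂ → i₂ < i₃ → blk i₁ ≡ blk i₂ → blk i₂ ≡ blk i₃ →
                       p i₁ + p i₃ ≢ 2 * p i₂
  blockwise-3AP-free {i₁} {i₂} {i₃} l₁₂ l₂₃ e₁₂ e₂₃ ap =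
    place-3AP-free {b} (off-mono l₁₂ e₁₂) (off-mono l₂₃ e₂₃) (off< i₃) (begin
      place b (off i₁) + place b (off i₃)   ≡⟨ cong (λ c → place c (off i₁) + p i₃) (sym e₁₃) ⟩
      p i₁ + p i₃                           ≡⟨ ap ⟩
      2 * p i₂                              ≡⟨ cong (λ c → 2 * place c (off i₂)) e₂₃ ⟩
      2 * place b (off i₂)                  ∎)
    where
    b : ℕ
    b = blk i₃
    e₁₃ : blk i₁ ≡ blk i₃
    e₁₃ = trans e₁₂ e₂₃
    open ≡-Reasoning

  -- A 4-AP of p, read over ℕ, gives two overlapping 3-APs.
  p-avoids-4AP : Contains4AP p → ⊥
  p-avoids-4AP (i₁ , i₂ , i₃ , i₄ , a , d , l₁₂ , l₂₃ , l₃₄ , _ , e₁ , e₂ , e₃ , e₄) =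
    no-4AP l₁₂ l₂₃ l₃₄ (integer-3AP a d (ℤ.+ 0) e₁ e₂ e₃) (integer-3AP a d (ℤ.+ 1) e₂ e₃ e₄)
    where open BlockedSequence p blk blk-mono (λ {i} {i'} → separated {i} {i'}) blockwise-3AP-free

  block-counted : ∀ b → size b ≤ count inS (U b)
  block-counted b = ≤-trans (count-run inS (pred (L b)) (size b) run) (count-mono inS run-end≤U)
    where
    run-end≤U : size b + pred (L b) ≤ U b
    run-end≤U = ≤-trans (+-monoʳ-≤ (size b) pred[n]≤n) (≤-reflexive (+-comm (size b) (L b)))
    L-suc : suc (pred (L b)) ≡ L b
    L-suc = suc-pred (L b) {{>-nonZero (Value.f-mono-≤ {0} {b} z≤n)}}
    run : ∀ i → i < size b → inS (suc (i + pred (L b))) ≡ true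
    run i i< = subst (λ v → inS v ≡ true) (trans (cong (i +_) (sym L-suc)) (+-suc i (pred (L b))))
      (in-block⇒member {b} (m≤n+m (L b) i)
        (subst (_< U b) (+-comm (L b) i) (+-monoʳ-< (L b) i<)))

  -- A non-member v lies in a gap [U b, 2 U b), so K · v < 2K · L b + 2K · size b;
  -- the first part is paid for by K · L b < size b ≤ v, the second by the
  -- fully counted block b.
  gap-density : ∀ n → inS (suc n) ≡ false → DensityAt inS K (suc n)
  gap-density n non-member = begin
    K * v                                    ≤⟨ *-monoʳ-≤ K (<⇒≤ (Value.below-next v)) ⟩
    K * (2 * (L b + size b))                 ≡⟨ expand K (L b) (size b) ⟩
    2 * (K * L b) + 2 * (K * size b)         ≤⟨ +-mono-≤ (*-monoʳ-≤ 2 (<⇒≤ (K*L<size b)))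
                                                         (*-monoʳ-≤ 2 (*-monoʳ-≤ K counted)) ⟩
    2 * size b + 2 * (K * count inS v)       ≤⟨ +-monoˡ-≤ _ (*-monoʳ-≤ 2 (≤-trans (m≤n+m (size b) (L b)) U≤v)) ⟩
    2 * v + 2 * (K * count inS v)            ≡⟨ regroup K (count inS v) v ⟩
    2 * K * count inS v + 2 * v              ∎
    where
    open ≤-Reasoning
    v b : ℕ
    v = suc n
    b = Value.loc v
    U≤v : U b ≤ v
    U≤v = non-member⇒in-gap non-member (s≤s z≤n)
    counted : size b ≤ count inS v
    counted = ≤-trans (block-counted b) (count-mono inS U≤v)
    expand : ∀ K l s → K * (2 * (l + s)) ≡ 2 * (K * l) + 2 * (K * s)
    expand = solve-∀
    regroup : ∀ K c v → 2 * v + 2 * (K * c) ≡ 2 * K * c + 2 * v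
    regroup = solve-∀

  density : ∀ n → DensityAt inS K n
  density = density-everywhere inS K gap-density

mainTheorem3 : (k : ℕ) → Σ SubsetPos λ S → (PermutableAvoiding4AP (proj₁ S) × EventuallyDensityAtLeastHalfMinus (proj₁ S) k)
mainTheorem3 k = (inS , refl) , (p , p-permutes-S , p-avoids-4AP) , (0 , λ n _ → density n)
  where open Construction (suc k)
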